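{- Let $S,T\in\{0,1,2\}^*$ and let $x,y,G_x$ and $x',y',G'_{x'}$ be as in the context. Then $\mathrm{dist}_{G_x}(x,y)=\mathrm{dist}_{G'_{x'}}(x',y')$.
   Context: Alphabet $\{0,1,2,\overline{2}\}$ with involution $\overline{0}=1$, $\overline{1}=0$, $2\leftrightarrow\overline{2}$; $\overleftarrow{X}=\overline{X[|X|]}\cdots\overline{X[1]}$. Construction: $I_L(0)=(010^3)^{55}$, $I_L(1)=(010^5)^{54}$, $I_L(2)=(010^7)^{53}$, $P_L=(010^9)^{144}$, $\mathrm{Sync}_L=01$, $I_R(\alpha)=\overleftarrow{I_L(\alpha)}$, $P_R=\overleftarrow{P_L}$, $\mathrm{Sync}_R=\overline{010}$; $E_L(\alpha)=P_L\mathrm{Sync}_LI_L(\alpha)\mathrm{Sync}_L$, $E_R(\alpha)=\mathrm{Sync}_RI_R(\alpha)\mathrm{Sync}_RP_R$; $y=P_L\,\mathrm{Sync}_L\,01\,11\overline{11}\,\overline{10}\,\mathrm{Sync}_R\,P_R$, $x=E_L(S[1])\cdots E_L(S[|S|])\,y\,E_R(T[|T|])\cdots E_R(T[1])$ (strings over $\{0,1\}$). $G_x$ (modified deletions): vertices are substrings $x[i..j]$ (identified by positions); edges from $x[i..j]$ to $x[i+\ell..j]$ and to $x[i..j-\ell]$ whenever $1\le\ell\le\lfloor(j-i+1)/2\rfloor$ and $x[i..i+\ell-1]=\overleftarrow{x[j-\ell+1..j]}$; $\mathrm{dist}_{G_x}(x,y)$ is the shortest path length from $x[1..|x|]$ to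 the unique occurrence of $y$ in $x$. Let $x_{\mathrm{mid}}$ (resp. $y_{\mathrm{mid}}$) be the unique index with $x[x_{\mathrm{mid}}-1..x_{\mathrm{mid}}+2]=11\overline{11}$ (resp. same for $y$). $x'$ has length $2|x|$ with $x'[2i-1..2i]=2\cdot x[i]$ for $i\le x_{\mathrm{mid}}$ and $x'[2i-1..2i]=x[i]\cdot\overline{2}$ for $i>x_{\mathrm{mid}}$; $y'$ is defined from $y$ and $y_{\mathrm{mid}}$ likewise. Original hairpin deletion: $W$ can be transformed by a right hairpin deletion of length $\ell\in[1..\lfloor|W|/2\rfloor]$ into its prefix $W'$ if $W=W'\cdot\overleftarrow{W'[1..\ell]}$ and $W'[\ell+1]=\overline{W'[|W'|]}$; by a left one into its suffix $W'$ if $W=\overleftarrow{W'[|W'|-\ell+1..|W'|]}\cdot W'$ and $W'[|W'|-\ell]=\overline{W'[1]}$. $G'_{x'}$: vertices are substrings $x'[i..j]$ (identified by positions), edge $u\to v$ if $v$ is obtained from $u$ by one such deletion; $\mathrm{dist}_{G'_{x'}}(x',y')$ is the shortest path length from $x'[1..|x'|]$ to the unique occurrence of $y'$ in $x'$. -}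

module Defs where

open import Data.Nat using (ℕ; zero; suc; _+_; _∸_; _≤_; _<_; _≤ᵇ_; _/_)
open import Data.Bool using (Bool; true; false; if_then_else_)
open import Data.Fin using (Fin)
open import Data.List using (List; []; _∷_; _++_; length; take; drop; reverse; map; concat; concatMap; replicate)
open import Data.Maybe using (Maybe; just; nothing; fromMaybe)
open import Data.Product using (_×_; _,_; ∃; Σ)
open import Relation.Binary.PropositionalEquality using (_≡_)
open import Relation.Nullary using (¬_)

data Sym : Set where
  s0 s1 s2 s2b : Sym

bar : Sym → Sym
bar s0  = s1
bar s1  = s0
bar s2  = s2b
bar s2b = s2

Word : Set
Word = List Sym

cmp : Word → Word
cmp = map bar

revbar : Word → Word
revbar w = reverse (map bar w)

-- 1-based lookup: at1 w k = just (w[k]) if 1 ≤ k ≤ |w|, else nothing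
at1 : Word → ℕ → Maybe Sym
at1 w       zero          = nothing
at1 []      (suc k)       = nothing
at1 (c ∷ w) (suc zero)    = just c
at1 (c ∷ w) (suc (suc k)) = at1 w (suc k)

-- substring with 0-based offset i and length m : x[i+1 .. i+m]
sub : Word → ℕ → ℕ → Word
sub x i m = take m (drop i x)

rep : ℕ → Word → Word
rep n w = concat (replicate n w)

zs : ℕ → Word
zs k = replicate k s0

blk : ℕ → ℕ → Word
blk n k = rep n (s0 ∷ s1 ∷ zs k)

IL : Fin 3 → Word
IL Fin.zero             = blk 55 3
IL (Fin.suc Fin.zero)   = blk 54 5
IL (Fin.suc (Fin.suc Fin.zero)) = blk 53 7

PL : Word
PL = blk 144 9

SyncL : Word
SyncL = s0 ∷ s1 ∷ []

IR : Fin 3 → Word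
IR α = revbar (IL α)

PR : Word
PR = revbar PL

SyncR : Word
SyncR = cmp (s0 ∷ s1 ∷ s0 ∷ [])

EL : Fin 3 → Word
EL α = PL ++ SyncL ++ IL α ++ SyncL

ER : Fin 3 → Word
ER α = SyncR ++ IR α ++ SyncR ++ PR

yStr : Word
yStr = PL ++ SyncL ++ (s0 ∷ s1 ∷ []) ++ (s1 ∷ s1 ∷ []) ++ cmp (s1 ∷ s1 ∷ [])
          ++ cmp (s1 ∷ s0 ∷ []) ++ SyncR ++ PR

xStr : List (Fin 3) → List (Fin 3) → Word
xStr S T = concatMap EL S ++ yStr ++ concatMap ER (reverse T)

-- does the word start with 1 1 \overline{1} \overline{1} = 1 1 0 0 ?
startsPat : Word → Bool
startsPat (s1 ∷ s1 ∷ s0 ∷ s0 ∷ _) = true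
startsPat _ = false

findPat : ℕ → Word → Maybe ℕ
findPat i [] = nothing
findPat i (c ∷ w) = if startsPat (c ∷ w) then just i else findPat (suc i) w

-- x_mid : the (1-based) index with x[x_mid-1 .. x_mid+2] = 11\overline{11}
-- (the first such index; the paper asserts it is unique; 0 if none exists)
mid : Word → ℕ
mid x = fromMaybe 0 (Data.Maybe.map (λ p → p + 2) (findPat 0 x))
  where import Data.Maybe

-- x'[2i-1..2i] = 2·x[i] for i ≤ md, = x[i]·\overline{2} for i > md  (i 1-based)
primeAux : ℕ → ℕ → Word → Word
primeAux md i [] = []
primeAux md i (c ∷ w) =
  (if i ≤ᵇ md then s2 ∷ c ∷ [] else c ∷ s2b ∷ []) ++ primeAux md (suc i) w

prime : Word → Word
prime x = primeAux (mid x) 1 x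

-- Graphs. A vertex (i , m) is the substring x[i+1 .. i+m].

V : Set
V = ℕ × ℕ

data DelEdge (x : Word) : V → V → Set where
  delLeft  : ∀ i m ℓ → 1 ≤ ℓ → ℓ ≤ m / 2 → i + m ≤ length x →
             take ℓ (sub x i m) ≡ revbar (drop (m ∸ ℓ) (sub x i m)) →
             DelEdge x (i , m) (i + ℓ , m ∸ ℓ)
  delRight : ∀ i m ℓ → 1 ≤ ℓ → ℓ ≤ m / 2 → i + m ≤ length x →
             take ℓ (sub x i m) ≡ revbar (drop (m ∸ ℓ) (sub x i m)) →
             DelEdge x (i , m) (i , m ∸ ℓ)

RightHP : Word → ℕ → Word → Set
RightHP W ℓ W' = (W ≡ W' ++ revbar (take ℓ W')) ×
                 ∃ λ b → at1 W' (length W') ≡ just b × at1 W' (suc ℓ) ≡ just (bar b)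

LeftHP : Word → ℕ → Word → Set
LeftHP W ℓ W' = (W ≡ revbar (drop (length W' ∸ ℓ) W') ++ W') ×
                ∃ λ b → at1 W' 1 ≡ just b × at1 W' (length W' ∸ ℓ) ≡ just (bar b)

data HPEdge (x : Word) : V → V → Set where
  hpRight : ∀ i m ℓ → 1 ≤ ℓ → ℓ ≤ m / 2 → i + m ≤ length x →
            RightHP (sub x i m) ℓ (take (m ∸ ℓ) (sub x i m)) →
            HPEdge x (i , m) (i , m ∸ ℓ)
  hpLeft  : ∀ i m ℓ → 1 ≤ ℓ → ℓ ≤ m / 2 → i + m ≤ length x →
            LeftHP (sub x i m) ℓ (drop ℓ (sub x i m)) →
            HPEdge x (i , m) (i + ℓ , m ∸ ℓ)

data Path {A : Set} (E : A → A → Set) : A → A → ℕ → Set where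
  here : ∀ {v} → Path E v v 0
  step : ∀ {u v w n} → E u v → Path E v w n → Path E u w (suc n)

Occ : Word → Word → V → Set
Occ x y (i , m) = (m ≡ length y) × (i + m ≤ length x) × (sub x i m ≡ y)

ReachIn : (V → V → Set) → V → (V → Set) → ℕ → Set
ReachIn E s P n = ∃ λ t → P t × Path E s t n

DistIs : (V → V → Set) → V → (V → Set) → ℕ → Set
DistIs E s P n = ReachIn E s P n × (∀ k → k < n → ¬ ReachIn E s P k)

distG : List (Fin 3) → List (Fin 3) → ℕ → Set
distG S T n = DistIs (DelEdge (xStr S T)) (0 , length (xStr S T)) (Occ (xStr S T) yStr) n

distG' : List (Fin 3) → List (Fin 3) → ℕ → Set
distG' S T n = DistIs (HPEdge (prime (xStr S T))) (0 , length (prime (xStr S T)))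
                      (Occ (prime (xStr S T)) (prime yStr)) n

-- x' is x with each letter c written as 2c up to x_mid and as c2̄ after it, so that the substring
-- x[i+1..i+m] corresponds to x'[2i+1..2i+2m]. A modified deletion of length ℓ is a stem: the first ℓ letters
-- are the reversed complement of the last ℓ. Stems survive the encoding (with length 2ℓ) when the switch
-- point x_mid lies between the two halves of the stem, and then the marks 2 and 2̄ at the inner ends of the halves
-- supply the extra condition of a hairpin deletion. Since x has a single 1100, no 11 left of it and no 00 right of
-- it, every stem of a substring containing y does straddle x_mid, so modified deletions lift to hairpin deletions.
-- Conversely, a hairpin deletion of odd length leaves a substring of odd length whose two ends are never
-- complementary, a dead end before y' is reached, and one of even length halves to a modified deletion. Hence
-- paths to y and to y' correspond step by step, and so do the distances.

module Submission where

open import Defs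
open import Data.Bool using (true; false)
open import Data.Empty using (⊥; ⊥-elim)
open import Data.Fin using (Fin)
open import Data.Fin.Properties using () renaming (all? to all-Fin?)
open import Data.List using (List; []; _∷_; _++_; length; take; drop; reverse; map; concatMap; head; last)
open import Data.List.Properties
  using (++-assoc; ++-identityʳ; length-++; length-map; length-reverse; map-++; reverse-++; unfold-reverse;
         length-take; length-drop; take++drop≡id; take-take; drop-drop)
open import Data.List.Relation.Unary.All using (All; []; _∷_; all?; universal)
open import Data.List.Relation.Unary.All.Properties using (++⁺; take⁺; drop⁺; concat⁺; map⁺)
open import Data.List.Relation.Unary.Linked as Linked using (Linked; []; _∷_; linked?)
open import Data.List.Relation.Unary.Linked.Properties using () renaming (++⁺ to ++⁺ᴸ)
open import Data.Maybe using (Maybe; just; nothing; fromMaybe)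
import Data.Maybe as Maybe
open import Data.Maybe.Relation.Binary.Connected using (Connected; just; just-nothing; nothing-just; nothing)
open import Data.Nat
  using (ℕ; zero; suc; _+_; _*_; _∸_; _≤_; _<_; _/_; _≤ᵇ_; z≤n; s≤s)
open import Data.Nat.Properties hiding (_≟_)
open import Data.Nat.DivMod using (m*n/n≡m; m/n*n≤m; /-monoˡ-≤)
open import Data.Nat.Tactic.RingSolver using (solve-∀)
open import Data.Product using (∃; _×_; _,_; proj₁; proj₂)
open import Data.Sum using (_⊎_; inj₁; inj₂)
open import Function.Bundles using (_⇔_; mk⇔; Equivalence)
import Function.Properties.Equivalence as ⇔
open import Relation.Binary.Definitions using (DecidableEquality; tri<; tri≈; tri>)
open import Relation.Nullary using (¬_; Dec; yes; no)
open import Relation.Nullary.Decidable using (¬?; _×-dec_; from-yes)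
open import Relation.Binary.PropositionalEquality

-- Positions in words, 0-based (Defs uses the 1-based at1)

at0 : Word → ℕ → Maybe Sym
at0 []      _       = nothing
at0 (c ∷ w) zero    = just c
at0 (c ∷ w) (suc r) = at0 w r

at1-suc : ∀ w r → at1 w (suc r) ≡ at0 w r
at1-suc []      r       = refl
at1-suc (c ∷ w) zero    = refl
at1-suc (c ∷ w) (suc r) = at1-suc w r

at0-take : ∀ k w r → r < k → at0 (take k w) r ≡ at0 w r
at0-take (suc k) []      r       _       = refl
at0-take (suc k) (c ∷ w) zero    _       = refl
at0-take (suc k) (c ∷ w) (suc r) (s≤s p) = at0-take k w r p

at0-drop : ∀ j w r → at0 (drop j w) r ≡ at0 w (j + r)
at0-drop zero    w       r = refl
at0-drop (suc j) []      r = refl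
at0-drop (suc j) (c ∷ w) r = at0-drop j w r

at0-sub : ∀ x i m r → r < m → at0 (sub x i m) r ≡ at0 x (i + r)
at0-sub x i m r p = trans (at0-take m (drop i x) r p) (at0-drop i x r)

at0-++ˡ : ∀ A B r → r < length A → at0 (A ++ B) r ≡ at0 A r
at0-++ˡ (c ∷ A) B zero    _       = refl
at0-++ˡ (c ∷ A) B (suc r) (s≤s p) = at0-++ˡ A B r p

at0-++ʳ : ∀ A B r → at0 (A ++ B) (length A + r) ≡ at0 B r
at0-++ʳ []      B r = refl
at0-++ʳ (c ∷ A) B r = at0-++ʳ A B r

at0-map : ∀ f w r → at0 (map f w) r ≡ Maybe.map f (at0 w r)
at0-map f []      r       = refl
at0-map f (c ∷ w) zero    = refl
at0-map f (c ∷ w) (suc r) = at0-map f w r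

at0-reverse : ∀ w r → r < length w → at0 (reverse w) r ≡ at0 w (length w ∸ suc r)
at0-reverse (c ∷ w) r p with m≤n⇒m<n∨m≡n (≤-pred p)
... | inj₁ r<w = begin
  at0 (reverse (c ∷ w)) r     ≡⟨ cong (λ u → at0 u r) (unfold-reverse c w) ⟩
  at0 (reverse w ++ c ∷ []) r ≡⟨ at0-++ˡ (reverse w) _ r (subst (r <_) (sym (length-reverse w)) r<w) ⟩
  at0 (reverse w) r           ≡⟨ at0-reverse w r r<w ⟩
  at0 w (length w ∸ suc r)    ≡⟨ cong (at0 (c ∷ w)) (sym (∸-suc r<w)) ⟩
  at0 (c ∷ w) (length w ∸ r)  ∎
  where
  open ≡-Reasoning
  ∸-suc : ∀ {r n} → r < n → n ∸ r ≡ suc (n ∸ suc r)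
  ∸-suc {zero}  {suc n} _       = refl
  ∸-suc {suc r} {suc n} (s≤s q) = ∸-suc q
... | inj₂ refl = begin
  at0 (reverse (c ∷ w)) (length w)              ≡⟨ cong (λ u → at0 u (length w)) (unfold-reverse c w) ⟩
  at0 (reverse w ++ c ∷ []) (length w)          ≡⟨ cong (at0 (reverse w ++ c ∷ [])) (sym (trans (+-identityʳ _) (length-reverse w))) ⟩
  at0 (reverse w ++ c ∷ []) (length (reverse w) + 0) ≡⟨ at0-++ʳ (reverse w) _ 0 ⟩
  just c                                        ≡⟨ cong (at0 (c ∷ w)) (sym (n∸n≡0 (length w))) ⟩
  at0 (c ∷ w) (length w ∸ length w)             ∎
  where open ≡-Reasoning

length-sub : ∀ x i m → i + m ≤ length x → length (sub x i m) ≡ m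
length-sub x i m p = trans (length-take m (drop i x)) (m≤n⇒m⊓n≡m m≤∣drop∣)
  where
  m≤∣drop∣ : m ≤ length (drop i x)
  m≤∣drop∣ = subst (m ≤_) (sym (length-drop i x)) (m+n≤o⇒m≤o∸n m (subst (_≤ length x) (+-comm i m) p))

take-of-take : ∀ {n m} (w : Word) → n ≤ m → take n (take m w) ≡ take n w
take-of-take {n} {m} w p = trans (take-take n m w) (cong (λ k → take k w) (m≤n⇒m⊓n≡m p))

take-++-length : ∀ (A B : Word) → take (length A) (A ++ B) ≡ A
take-++-length []      B = refl
take-++-length (c ∷ A) B = cong (c ∷_) (take-++-length A B)

drop-++-length : ∀ (A B : Word) → drop (length A) (A ++ B) ≡ B
drop-++-length []      B = refl
drop-++-length (c ∷ A) B = drop-++-length A B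

bar-involutive : ∀ c → bar (bar c) ≡ c
bar-involutive s0  = refl
bar-involutive s1  = refl
bar-involutive s2  = refl
bar-involutive s2b = refl

map-bar-just : ∀ u c → Maybe.map bar u ≡ just c → u ≡ just (bar c)
map-bar-just (just d) c refl = cong just (sym (bar-involutive d))

revbar-++ : ∀ A B → revbar (A ++ B) ≡ revbar B ++ revbar A
revbar-++ A B = trans (cong reverse (map-++ bar A B)) (reverse-++ (map bar A) (map bar B))

revbar-∷ : ∀ c A → revbar (c ∷ A) ≡ revbar A ++ bar c ∷ []
revbar-∷ c A = revbar-++ (c ∷ []) A

revbar-involutive : ∀ A → revbar (revbar A) ≡ A
revbar-involutive [] = refl
revbar-involutive (c ∷ A) = begin
  revbar (revbar (c ∷ A))                ≡⟨ cong revbar (revbar-∷ c A) ⟩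
  revbar (revbar A ++ bar c ∷ [])        ≡⟨ revbar-++ (revbar A) (bar c ∷ []) ⟩
  bar (bar c) ∷ revbar (revbar A)        ≡⟨ cong₂ _∷_ (bar-involutive c) (revbar-involutive A) ⟩
  c ∷ A                                  ∎
  where open ≡-Reasoning

length-revbar : ∀ A → length (revbar A) ≡ length A
length-revbar A = trans (length-reverse (map bar A)) (length-map bar A)

at0-revbar : ∀ w r → r < length w → at0 (revbar w) r ≡ Maybe.map bar (at0 w (length w ∸ suc r))
at0-revbar w r p = begin
  at0 (reverse (map bar w)) r                   ≡⟨ at0-reverse (map bar w) r (subst (r <_) (sym (length-map bar w)) p) ⟩
  at0 (map bar w) (length (map bar w) ∸ suc r)  ≡⟨ cong (λ n → at0 (map bar w) (n ∸ suc r)) (length-map bar w) ⟩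
  at0 (map bar w) (length w ∸ suc r)            ≡⟨ at0-map bar w _ ⟩
  Maybe.map bar (at0 w (length w ∸ suc r))      ∎
  where open ≡-Reasoning

-- Doubling, the index map from x to x'

double : ℕ → ℕ
double zero    = zero
double (suc n) = suc (suc (double n))

double≡+ : ∀ n → double n ≡ n + n
double≡+ zero    = refl
double≡+ (suc n) = cong suc (trans (cong suc (double≡+ n)) (sym (+-suc n n)))

double≡*2 : ∀ n → double n ≡ n * 2
double≡*2 n = trans (double≡+ n) (+n≡*2 n)
  where
  +n≡*2 : ∀ n → n + n ≡ n * 2
  +n≡*2 = solve-∀

double-+ : ∀ a b → double (a + b) ≡ double a + double b
double-+ zero    b = refl
double-+ (suc a) b = cong (λ n → suc (suc n)) (double-+ a b)

double-∸ : ∀ a b → double (a ∸ b) ≡ double a ∸ double b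
double-∸ a       zero    = refl
double-∸ zero    (suc b) = refl
double-∸ (suc a) (suc b) = double-∸ a b

double-mono-≤ : ∀ {a b} → a ≤ b → double a ≤ double b
double-mono-≤ z≤n     = z≤n
double-mono-≤ (s≤s p) = s≤s (s≤s (double-mono-≤ p))

double-cancel-≤ : ∀ {a b} → double a ≤ double b → a ≤ b
double-cancel-≤ {zero}              _                 = z≤n
double-cancel-≤ {suc a} {suc b} (s≤s (s≤s p)) = s≤s (double-cancel-≤ p)

double-injective : ∀ {a b} → double a ≡ double b → a ≡ b
double-injective e = ≤-antisym (double-cancel-≤ (≤-reflexive e)) (double-cancel-≤ (≤-reflexive (sym e)))

double≢odd : ∀ a b → double a ≢ suc (double b)
double≢odd zero    b       ()
double≢odd (suc a) zero    ()
double≢odd (suc a) (suc b) e = double≢odd a b (suc-injective (suc-injective e))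

double-∸-odd : ∀ {m k} → suc k ≤ m → double m ∸ suc (double k) ≡ suc (double (m ∸ suc k))
double-∸-odd {suc m} {zero}  _       = refl
double-∸-odd {suc m} {suc k} (s≤s p) = double-∸-odd p

even-or-odd : ∀ n → ∃ λ k → n ≡ double k ⊎ n ≡ suc (double k)
even-or-odd zero = 0 , inj₁ refl
even-or-odd (suc n) with even-or-odd n
... | k , inj₁ e = k , inj₂ (cong suc e)
... | k , inj₂ e = suc k , inj₁ (cong suc e)

double/2 : ∀ m → double m / 2 ≡ m
double/2 m = trans (cong (_/ 2) (double≡*2 m)) (m*n/n≡m m 2)

≤/2⇒double≤ : ∀ {k m} → k ≤ m / 2 → double k ≤ m
≤/2⇒double≤ {k} {m} p = subst (_≤ m) (sym (double≡*2 k)) (≤-trans (*-monoˡ-≤ 2 p) (m/n*n≤m m 2))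

1≤double⁻ : ∀ {k} → 1 ≤ double k → 1 ≤ k
1≤double⁻ {suc k} _ = s≤s z≤n

double≤⇒≤/2 : ∀ {k m} → double k ≤ m → k ≤ m / 2
double≤⇒≤/2 {k} {m} p = subst (_≤ m / 2) (double/2 k) (/-monoˡ-≤ 2 p)

halve-≤/2 : ∀ {k m} → double k ≤ double m / 2 → k ≤ m / 2
halve-≤/2 {k} {m} p = double≤⇒≤/2 (subst (double k ≤_) (double/2 m) p)

≤/2⇒+≤ : ∀ {k m} → k ≤ m / 2 → k + k ≤ m
≤/2⇒+≤ {k} {m} p = subst (_≤ m) (double≡+ k) (≤/2⇒double≤ p)

≤/2⇒≤ : ∀ {k m} → k ≤ m / 2 → k ≤ m
≤/2⇒≤ {k} p = ≤-trans (m≤m+n k k) (≤/2⇒+≤ p)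

+≤⇒≤∸ : ∀ {k m} → k + k ≤ m → k ≤ m ∸ k
+≤⇒≤∸ {k} {m} p = subst (_≤ m ∸ k) (m+n∸n≡m k k) (∸-monoˡ-≤ k p)

-- Stems: the condition shared by both kinds of deletion

Stem : Word → ℕ → ℕ → Set
Stem W m ℓ = take ℓ W ≡ revbar (drop (m ∸ ℓ) W)

stem-at0 : ∀ W m k → length W ≡ m → k ≤ m → Stem W m k →
           ∀ r → r < k → at0 W r ≡ Maybe.map bar (at0 W (m ∸ suc r))
stem-at0 W m k lW k≤m st r r<k = begin
  at0 W r                                   ≡⟨ sym (at0-take k W r r<k) ⟩
  at0 (take k W) r                          ≡⟨ cong (λ u → at0 u r) st ⟩
  at0 (revbar D) r                          ≡⟨ at0-revbar D r (subst (r <_) (sym lD) r<k) ⟩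
  Maybe.map bar (at0 D (length D ∸ suc r))  ≡⟨ cong (λ n → Maybe.map bar (at0 D (n ∸ suc r))) lD ⟩
  Maybe.map bar (at0 D (k ∸ suc r))         ≡⟨ cong (Maybe.map bar) (at0-drop (m ∸ k) W (k ∸ suc r)) ⟩
  Maybe.map bar (at0 W (m ∸ k + (k ∸ suc r))) ≡⟨ cong (λ n → Maybe.map bar (at0 W n)) index ⟩
  Maybe.map bar (at0 W (m ∸ suc r))         ∎
  where
  open ≡-Reasoning
  D : Word
  D = drop (m ∸ k) W
  lD : length D ≡ k
  lD = trans (length-drop (m ∸ k) W) (trans (cong (_∸ (m ∸ k)) lW) (m∸[m∸n]≡n k≤m))
  index : m ∸ k + (k ∸ suc r) ≡ m ∸ suc r
  index = trans (sym (+-∸-assoc (m ∸ k) r<k)) (cong (_∸ suc r) (m∸n+n≡m k≤m))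

RightHP⇒Stem : ∀ W m ℓ → length W ≡ m → ℓ + ℓ ≤ m → RightHP W ℓ (take (m ∸ ℓ) W) → Stem W m ℓ
RightHP⇒Stem W m ℓ lW ℓℓ (W≡ , _) = begin
  take ℓ W                     ≡⟨ sym (take-of-take W (+≤⇒≤∸ {ℓ} {m} ℓℓ)) ⟩
  take ℓ W'                    ≡⟨ sym (revbar-involutive _) ⟩
  revbar (revbar (take ℓ W'))  ≡⟨ cong revbar (sym tail) ⟩
  revbar (drop (m ∸ ℓ) W)      ∎
  where
  open ≡-Reasoning
  W' : Word
  W' = take (m ∸ ℓ) W
  lW' : length W' ≡ m ∸ ℓ
  lW' = trans (length-take (m ∸ ℓ) W) (m≤n⇒m⊓n≡m (subst (m ∸ ℓ ≤_) (sym lW) (m∸n≤m m ℓ)))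
  tail : drop (m ∸ ℓ) W ≡ revbar (take ℓ W')
  tail = trans (cong (drop (m ∸ ℓ)) W≡)
               (trans (cong (λ n → drop n (W' ++ revbar (take ℓ W'))) (sym lW')) (drop-++-length W' _))

LeftHP⇒Stem : ∀ W m ℓ → length W ≡ m → ℓ + ℓ ≤ m → LeftHP W ℓ (drop ℓ W) → Stem W m ℓ
LeftHP⇒Stem W m ℓ lW ℓℓ (W≡ , _) = begin
  take ℓ W                                   ≡⟨ cong (take ℓ) W≡ ⟩
  take ℓ (R ++ W')                           ≡⟨ cong (λ n → take n (R ++ W')) (sym lR) ⟩
  take (length R) (R ++ W')                  ≡⟨ take-++-length R W' ⟩
  R                                          ≡⟨ cong revbar (drop-drop ℓ (length W' ∸ ℓ) W) ⟩
  revbar (drop (ℓ + (length W' ∸ ℓ)) W)      ≡⟨ cong (λ n → revbar (drop (ℓ + (n ∸ ℓ)) W)) lW' ⟩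
  revbar (drop (ℓ + (m ∸ ℓ ∸ ℓ)) W)          ≡⟨ cong (λ n → revbar (drop n W)) (m+[n∸m]≡n (+≤⇒≤∸ {ℓ} {m} ℓℓ)) ⟩
  revbar (drop (m ∸ ℓ) W)                    ∎
  where
  open ≡-Reasoning
  W' : Word
  W' = drop ℓ W
  lW' : length W' ≡ m ∸ ℓ
  lW' = trans (length-drop ℓ W) (cong (_∸ ℓ) lW)
  R : Word
  R = revbar (drop (length W' ∸ ℓ) W')
  lR : length R ≡ ℓ
  lR = trans (length-revbar (drop (length W' ∸ ℓ) W')) (trans (length-drop (length W' ∸ ℓ) W')
             (m∸[m∸n]≡n (subst (ℓ ≤_) (sym lW') (+≤⇒≤∸ {ℓ} {m} ℓℓ))))

stem⇒right-split : ∀ W m ℓ → ℓ + ℓ ≤ m → Stem W m ℓ →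
                   W ≡ take (m ∸ ℓ) W ++ revbar (take ℓ (take (m ∸ ℓ) W))
stem⇒right-split W m ℓ ℓℓ st = begin
  W                                                   ≡⟨ sym (take++drop≡id (m ∸ ℓ) W) ⟩
  take (m ∸ ℓ) W ++ drop (m ∸ ℓ) W                    ≡⟨ cong (take (m ∸ ℓ) W ++_) (trans (sym (revbar-involutive _)) (cong revbar (sym st))) ⟩
  take (m ∸ ℓ) W ++ revbar (take ℓ W)                 ≡⟨ cong (λ u → take (m ∸ ℓ) W ++ revbar u) (sym (take-of-take W (+≤⇒≤∸ {ℓ} {m} ℓℓ))) ⟩
  take (m ∸ ℓ) W ++ revbar (take ℓ (take (m ∸ ℓ) W))  ∎
  where open ≡-Reasoning

stem⇒left-split : ∀ W m ℓ → length W ≡ m → ℓ + ℓ ≤ m → Stem W m ℓ →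
                  W ≡ revbar (drop (length (drop ℓ W) ∸ ℓ) (drop ℓ W)) ++ drop ℓ W
stem⇒left-split W m ℓ lW ℓℓ st = begin
  W                                                         ≡⟨ sym (take++drop≡id ℓ W) ⟩
  take ℓ W ++ drop ℓ W                                      ≡⟨ cong (_++ drop ℓ W) st ⟩
  revbar (drop (m ∸ ℓ) W) ++ drop ℓ W                       ≡⟨ cong (λ n → revbar (drop n W) ++ drop ℓ W) (sym (m+[n∸m]≡n (+≤⇒≤∸ {ℓ} {m} ℓℓ))) ⟩
  revbar (drop (ℓ + (m ∸ ℓ ∸ ℓ)) W) ++ drop ℓ W             ≡⟨ cong (λ n → revbar (drop (ℓ + (n ∸ ℓ)) W) ++ drop ℓ W) (sym lW') ⟩
  revbar (drop (ℓ + (length (drop ℓ W) ∸ ℓ)) W) ++ drop ℓ W ≡⟨ cong (λ u → revbar u ++ drop ℓ W) (sym (drop-drop ℓ _ W)) ⟩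
  revbar (drop (length (drop ℓ W) ∸ ℓ) (drop ℓ W)) ++ drop ℓ W ∎
  where
  open ≡-Reasoning
  lW' : length (drop ℓ W) ≡ m ∸ ℓ
  lW' = trans (length-drop ℓ W) (cong (_∸ ℓ) lW)

module _ (X : Word) (i M ℓ j : ℕ) {c : Sym} (1≤ℓ : 1 ≤ ℓ) (ℓ≤M/2 : ℓ ≤ M / 2) (iM≤X : i + M ≤ length X)
         (st : Stem (sub X i M) M ℓ) (sj≡M∸ℓ : suc j ≡ M ∸ ℓ) (ℓ≤j : ℓ ≤ j)
         (atℓ : at0 X (i + ℓ) ≡ just c) (atj : at0 X (i + j) ≡ just (bar c)) where

  private
    W : Word
    W = sub X i M
    lW : length W ≡ M
    lW = length-sub X i M iM≤X
    ℓℓ : ℓ + ℓ ≤ M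
    ℓℓ = ≤/2⇒+≤ ℓ≤M/2
    j<M∸ℓ : j < M ∸ ℓ
    j<M∸ℓ = subst (j <_) sj≡M∸ℓ ≤-refl
    j<M : j < M
    j<M = ≤-trans j<M∸ℓ (m∸n≤m M ℓ)
    ℓ<M : ℓ < M
    ℓ<M = ≤-trans (s≤s ℓ≤j) j<M

  hpRight-of-stem : HPEdge X (i , M) (i , M ∸ ℓ)
  hpRight-of-stem = hpRight i M ℓ 1≤ℓ ℓ≤M/2 iM≤X (stem⇒right-split W M ℓ ℓℓ st , bar c , final , first)
    where
    W' = take (M ∸ ℓ) W
    at0W' : ∀ r → r ≤ j → at0 W' r ≡ at0 X (i + r)
    at0W' r r≤j = trans (at0-take (M ∸ ℓ) W r (≤-trans (s≤s r≤j) j<M∸ℓ)) (at0-sub X i M r (≤-trans (s≤s r≤j) j<M))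
    lW' : length W' ≡ suc j
    lW' = trans (length-take (M ∸ ℓ) W) (trans (m≤n⇒m⊓n≡m (subst (M ∸ ℓ ≤_) (sym lW) (m∸n≤m M ℓ))) (sym sj≡M∸ℓ))
    final : at1 W' (length W') ≡ just (bar c)
    final = trans (cong (at1 W') lW') (trans (at1-suc W' j) (trans (at0W' j ≤-refl) atj))
    first : at1 W' (suc ℓ) ≡ just (bar (bar c))
    first = trans (at1-suc W' ℓ) (trans (at0W' ℓ ℓ≤j) (trans atℓ (cong just (sym (bar-involutive c)))))

  hpLeft-of-stem : HPEdge X (i , M) (i + ℓ , M ∸ ℓ)
  hpLeft-of-stem = hpLeft i M ℓ 1≤ℓ ℓ≤M/2 iM≤X (stem⇒left-split W M ℓ lW ℓℓ st , c , first , final)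
    where
    W' : Word
    W' = drop ℓ W
    at0W' : ∀ r → ℓ + r < M → at0 W' r ≡ at0 X (i + (ℓ + r))
    at0W' r p = trans (at0-drop ℓ W r) (at0-sub X i M (ℓ + r) p)
    lW'∸ℓ : length W' ∸ ℓ ≡ suc (j ∸ ℓ)
    lW'∸ℓ = trans (cong (_∸ ℓ) (trans (length-drop ℓ W) (trans (cong (_∸ ℓ) lW) (sym sj≡M∸ℓ)))) (+-∸-assoc 1 ℓ≤j)
    first : at1 W' 1 ≡ just c
    first = trans (at1-suc W' 0) (trans (at0W' 0 (subst (_< M) (sym (+-identityʳ ℓ)) ℓ<M))
                  (trans (cong (λ n → at0 X (i + n)) (+-identityʳ ℓ)) atℓ))
    final : at1 W' (length W' ∸ ℓ) ≡ just (bar c)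
    final = trans (cong (at1 W') lW'∸ℓ)
                 (trans (at1-suc W' (j ∸ ℓ))
                   (trans (at0W' (j ∸ ℓ) (subst (_< M) (sym ℓ+[j∸ℓ]) j<M))
                     (trans (cong (λ n → at0 X (i + n)) ℓ+[j∸ℓ]) atj)))
      where
      ℓ+[j∸ℓ] : ℓ + (j ∸ ℓ) ≡ j
      ℓ+[j∸ℓ] = m+[n∸m]≡n ℓ≤j

hpEdge-stem : ∀ {X i M v} → HPEdge X (i , M) v → ∃ λ ℓ → 1 ≤ ℓ × ℓ + ℓ ≤ M × i + M ≤ length X × Stem (sub X i M) M ℓ
hpEdge-stem (hpRight i m ℓ 1≤ℓ ℓ≤m/2 im≤X h) =
  ℓ , 1≤ℓ , ≤/2⇒+≤ ℓ≤m/2 , im≤X , RightHP⇒Stem (sub _ i m) m ℓ (length-sub _ i m im≤X) (≤/2⇒+≤ ℓ≤m/2) h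
hpEdge-stem (hpLeft i m ℓ 1≤ℓ ℓ≤m/2 im≤X h) =
  ℓ , 1≤ℓ , ≤/2⇒+≤ ℓ≤m/2 , im≤X , LeftHP⇒Stem (sub _ i m) m ℓ (length-sub _ i m im≤X) (≤/2⇒+≤ ℓ≤m/2) h

hpEdge-bound : ∀ {X i M v} → HPEdge X (i , M) v → i + M ≤ length X
hpEdge-bound (hpRight _ _ _ _ _ iM≤X _) = iM≤X
hpEdge-bound (hpLeft _ _ _ _ _ iM≤X _)  = iM≤X

hpEdge-ends : ∀ {X i q v} → HPEdge X (i , suc q) v → at0 X i ≡ Maybe.map bar (at0 X (i + q))
hpEdge-ends {X} {i} {q} e with hpEdge-stem e
... | ℓ , 1≤ℓ , ℓℓ , iM≤X , st = begin
  at0 X i                             ≡⟨ cong (at0 X) (sym (+-identityʳ i)) ⟩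
  at0 X (i + 0)                       ≡⟨ sym (at0-sub X i (suc q) 0 (s≤s z≤n)) ⟩
  at0 (sub X i (suc q)) 0             ≡⟨ stem-at0 (sub X i (suc q)) (suc q) ℓ (length-sub X i (suc q) iM≤X) ℓ≤M st 0 1≤ℓ ⟩
  Maybe.map bar (at0 (sub X i (suc q)) q) ≡⟨ cong (Maybe.map bar) (at0-sub X i (suc q) q ≤-refl) ⟩
  Maybe.map bar (at0 X (i + q))       ∎
  where
  open ≡-Reasoning
  ℓ≤M : ℓ ≤ suc q
  ℓ≤M = ≤-trans (m≤m+n ℓ ℓ) ℓℓ

mark : ℕ → Word → Word
mark d       []      = []
mark zero    (c ∷ w) = c ∷ s2b ∷ mark zero w
mark (suc d) (c ∷ w) = s2 ∷ c ∷ mark d w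

prime≡mark : ∀ x → prime x ≡ mark (mid x) x
prime≡mark x = primeAux≡mark (mid x) 0 x
  where
  ≤ᵇ-cases : ∀ d i → ((suc i ≤ᵇ d) ≡ true × d ∸ i ≡ suc (d ∸ suc i)) ⊎ ((suc i ≤ᵇ d) ≡ false × d ∸ i ≡ 0 × d ∸ suc i ≡ 0)
  ≤ᵇ-cases zero    i       = inj₂ (refl , 0∸n≡0 i , 0∸n≡0 (suc i))
  ≤ᵇ-cases (suc d) zero    = inj₁ (refl , refl)
  ≤ᵇ-cases (suc d) (suc i) = ≤ᵇ-cases d i
  primeAux≡mark : ∀ d i w → primeAux d (suc i) w ≡ mark (d ∸ i) w
  primeAux≡mark d i [] = refl
  primeAux≡mark d i (c ∷ w) with ≤ᵇ-cases d i
  ... | inj₁ (e₁ , e₂) rewrite e₁ | e₂ = cong (λ u → s2 ∷ c ∷ u) (primeAux≡mark d (suc i) w)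
  ... | inj₂ (e₁ , e₂ , e₃) rewrite e₁ | e₂ =
    cong (λ u → c ∷ s2b ∷ u) (trans (primeAux≡mark d (suc i) w) (cong (λ n → mark n w) e₃))

length-mark : ∀ d w → length (mark d w) ≡ double (length w)
length-mark d       []      = refl
length-mark zero    (c ∷ w) = cong (λ n → suc (suc n)) (length-mark zero w)
length-mark (suc d) (c ∷ w) = cong (λ n → suc (suc n)) (length-mark d w)

take-mark : ∀ d m w → take (double m) (mark d w) ≡ mark d (take m w)
take-mark d       zero    w       = refl
take-mark d       (suc m) []      = refl
take-mark zero    (suc m) (c ∷ w) = cong (λ u → c ∷ s2b ∷ u) (take-mark zero m w)
take-mark (suc d) (suc m) (c ∷ w) = cong (λ u → s2 ∷ c ∷ u) (take-mark d m w)

drop-mark : ∀ d j w → drop (double j) (mark d w) ≡ mark (d ∸ j) (drop j w)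
drop-mark d       zero    w       = refl
drop-mark d       (suc j) []      = refl
drop-mark zero    (suc j) (c ∷ w) = trans (drop-mark zero j w) (cong (λ n → mark n (drop j w)) (0∸n≡0 j))
drop-mark (suc d) (suc j) (c ∷ w) = drop-mark d j w

sub-mark : ∀ d x i m → sub (mark d x) (double i) (double m) ≡ mark (d ∸ i) (sub x i m)
sub-mark d x i m = trans (cong (take (double m)) (drop-mark d i x)) (take-mark (d ∸ i) m (drop i x))

mark-++ : ∀ d A B → mark d (A ++ B) ≡ mark d A ++ mark (d ∸ length A) B
mark-++ d       []      B = refl
mark-++ zero    (c ∷ A) B =
  cong (λ u → c ∷ s2b ∷ u) (trans (mark-++ zero A B)
    (cong (λ n → mark zero A ++ mark n B) (trans (0∸n≡0 (length A)) (sym (0∸n≡0 (suc (length A)))))))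
mark-++ (suc d) (c ∷ A) B = cong (λ u → s2 ∷ c ∷ u) (mark-++ d A B)

mark-saturated : ∀ {d d'} w → length w ≤ d → length w ≤ d' → mark d w ≡ mark d' w
mark-saturated                 []      _       _       = refl
mark-saturated {suc d} {suc d'} (c ∷ w) (s≤s p) (s≤s q) = cong (λ u → s2 ∷ c ∷ u) (mark-saturated w p q)

-- Reversal swaps the two kinds of marks: c2̄ read backwards is 2c̄.
revbar-mark : ∀ u → revbar (mark 0 u) ≡ mark (length u) (revbar u)
revbar-mark []      = refl
revbar-mark (c ∷ u) = begin
  revbar ((c ∷ s2b ∷ []) ++ mark 0 u)                    ≡⟨ revbar-++ (c ∷ s2b ∷ []) (mark 0 u) ⟩
  revbar (mark 0 u) ++ s2 ∷ bar c ∷ []                   ≡⟨ cong (_++ s2 ∷ bar c ∷ []) (revbar-mark u) ⟩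
  mark (length u) (revbar u) ++ s2 ∷ bar c ∷ []          ≡⟨ cong (_++ s2 ∷ bar c ∷ []) (mark-saturated (revbar u) ∣revbar∣≤∣u∣ (≤-trans ∣revbar∣≤∣u∣ (n≤1+n _))) ⟩
  mark (suc (length u)) (revbar u) ++ mark 1 (bar c ∷ []) ≡⟨ cong (λ n → mark (suc (length u)) (revbar u) ++ mark n (bar c ∷ [])) (sym 1+u∸u≡1) ⟩
  mark (suc (length u)) (revbar u) ++ mark (suc (length u) ∸ length (revbar u)) (bar c ∷ [])
                                                         ≡⟨ sym (mark-++ (suc (length u)) (revbar u) (bar c ∷ [])) ⟩
  mark (suc (length u)) (revbar u ++ bar c ∷ [])         ≡⟨ cong (mark (suc (length u))) (sym (revbar-∷ c u)) ⟩
  mark (suc (length u)) (revbar (c ∷ u))                 ∎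
  where
  open ≡-Reasoning
  ∣revbar∣≤∣u∣ : length (revbar u) ≤ length u
  ∣revbar∣≤∣u∣ = ≤-reflexive (length-revbar u)
  1+u∸u≡1 : suc (length u) ∸ length (revbar u) ≡ 1
  1+u∸u≡1 = trans (cong (suc (length u) ∸_) (length-revbar u)) (trans (+-∸-assoc 1 {length u} ≤-refl) (cong suc (n∸n≡0 (length u))))

at0-mark-left-even : ∀ d x j → j < d → j < length x → at0 (mark d x) (double j) ≡ just s2
at0-mark-left-even (suc d) (c ∷ x) zero    _       _       = refl
at0-mark-left-even (suc d) (c ∷ x) (suc j) (s≤s p) (s≤s q) = at0-mark-left-even d x j p q

at0-mark-right-odd : ∀ d x j → d ≤ j → j < length x → at0 (mark d x) (suc (double j)) ≡ just s2b
at0-mark-right-odd zero    (c ∷ x) zero    _       _       = refl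
at0-mark-right-odd zero    (c ∷ x) (suc j) _       (s≤s q) = at0-mark-right-odd zero x j z≤n q
at0-mark-right-odd (suc d) (c ∷ x) (suc j) (s≤s p) (s≤s q) = at0-mark-right-odd d x j p q

data Binary : Sym → Set where
  0-binary : Binary s0
  1-binary : Binary s1

at0-mark-even≢2̄ : ∀ d x j → All Binary x → at0 (mark d x) (double j) ≢ just s2b
at0-mark-even≢2̄ d       []      j       _              ()
at0-mark-even≢2̄ zero    (c ∷ x) zero    (0-binary ∷ _) ()
at0-mark-even≢2̄ zero    (c ∷ x) zero    (1-binary ∷ _) ()
at0-mark-even≢2̄ (suc d) (c ∷ x) zero    _              ()
at0-mark-even≢2̄ zero    (c ∷ x) (suc j) (_ ∷ bx)       = at0-mark-even≢2̄ zero x j bx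
at0-mark-even≢2̄ (suc d) (c ∷ x) (suc j) (_ ∷ bx)       = at0-mark-even≢2̄ d x j bx

at0-mark-odd≢2 : ∀ d x j → All Binary x → at0 (mark d x) (suc (double j)) ≢ just s2
at0-mark-odd≢2 d       []      j       _              ()
at0-mark-odd≢2 zero    (c ∷ x) zero    _              ()
at0-mark-odd≢2 (suc d) (c ∷ x) zero    (0-binary ∷ _) ()
at0-mark-odd≢2 (suc d) (c ∷ x) zero    (1-binary ∷ _) ()
at0-mark-odd≢2 zero    (c ∷ x) (suc j) (_ ∷ bx)       = at0-mark-odd≢2 zero x j bx
at0-mark-odd≢2 (suc d) (c ∷ x) (suc j) (_ ∷ bx)       = at0-mark-odd≢2 d x j bx

unmark : Word → Word
unmark []          = []
unmark (s0 ∷ w)    = s0 ∷ unmark w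
unmark (s1 ∷ w)    = s1 ∷ unmark w
unmark (s2 ∷ w)    = unmark w
unmark (s2b ∷ w)   = unmark w

unmark-++ : ∀ A B → unmark (A ++ B) ≡ unmark A ++ unmark B
unmark-++ []        B = refl
unmark-++ (s0 ∷ A)  B = cong (s0 ∷_) (unmark-++ A B)
unmark-++ (s1 ∷ A)  B = cong (s1 ∷_) (unmark-++ A B)
unmark-++ (s2 ∷ A)  B = unmark-++ A B
unmark-++ (s2b ∷ A) B = unmark-++ A B

unmark-revbar : ∀ w → unmark (revbar w) ≡ revbar (unmark w)
unmark-revbar []      = refl
unmark-revbar (c ∷ w) = begin
  unmark (revbar (c ∷ w))                   ≡⟨ cong unmark (revbar-∷ c w) ⟩
  unmark (revbar w ++ bar c ∷ [])           ≡⟨ unmark-++ (revbar w) _ ⟩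
  unmark (revbar w) ++ unmark (bar c ∷ [])  ≡⟨ cong (_++ unmark (bar c ∷ [])) (unmark-revbar w) ⟩
  revbar (unmark w) ++ unmark (bar c ∷ [])  ≡⟨ final c ⟩
  revbar (unmark (c ∷ w))                   ∎
  where
  open ≡-Reasoning
  final : ∀ c → revbar (unmark w) ++ unmark (bar c ∷ []) ≡ revbar (unmark (c ∷ w))
  final s0  = sym (revbar-∷ s0 (unmark w))
  final s1  = sym (revbar-∷ s1 (unmark w))
  final s2  = ++-identityʳ _
  final s2b = ++-identityʳ _

unmark-mark : ∀ d w → All Binary w → unmark (mark d w) ≡ w
unmark-mark d       []       _              = refl
unmark-mark zero    (s0 ∷ w) (0-binary ∷ bs) = cong (s0 ∷_) (unmark-mark zero w bs)
unmark-mark zero    (s1 ∷ w) (1-binary ∷ bs) = cong (s1 ∷_) (unmark-mark zero w bs)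
unmark-mark (suc d) (s0 ∷ w) (0-binary ∷ bs) = cong (s0 ∷_) (unmark-mark d w bs)
unmark-mark (suc d) (s1 ∷ w) (1-binary ∷ bs) = cong (s1 ∷_) (unmark-mark d w bs)

stem-mark : ∀ d w m k → length w ≡ m → k ≤ m → k ≤ d → d ≤ m ∸ k →
            Stem w m k → Stem (mark d w) (double m) (double k)
stem-mark d w m k lw k≤m k≤d d≤m∸k st = begin
  take (double k) (mark d w)                  ≡⟨ take-mark d k w ⟩
  mark d P                                    ≡⟨ mark-saturated P (subst (_≤ d) (sym lP) k≤d) ≤-refl ⟩
  mark (length P) P                           ≡⟨ cong (λ u → mark (length u) u) st ⟩
  mark (length (revbar S)) (revbar S)         ≡⟨ cong (λ n → mark n (revbar S)) (length-revbar S) ⟩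
  mark (length S) (revbar S)                  ≡⟨ sym (revbar-mark S) ⟩
  revbar (mark 0 S)                           ≡⟨ cong (λ n → revbar (mark n S)) (sym (m≤n⇒m∸n≡0 d≤m∸k)) ⟩
  revbar (mark (d ∸ (m ∸ k)) S)               ≡⟨ cong revbar (sym (drop-mark d (m ∸ k) w)) ⟩
  revbar (drop (double (m ∸ k)) (mark d w))   ≡⟨ cong (λ n → revbar (drop n (mark d w))) (double-∸ m k) ⟩
  revbar (drop (double m ∸ double k) (mark d w)) ∎
  where
  open ≡-Reasoning
  P : Word
  P = take k w
  S : Word
  S = drop (m ∸ k) w
  lP : length P ≡ k
  lP = trans (length-take k w) (m≤n⇒m⊓n≡m (subst (k ≤_) (sym lw) k≤m))

stem-unmark : ∀ d w m k → All Binary w → Stem (mark d w) (double m) (double k) → Stem w m k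
stem-unmark d w m k bw st = begin
  take k w                                          ≡⟨ sym (unmark-mark d (take k w) (take⁺ k bw)) ⟩
  unmark (mark d (take k w))                        ≡⟨ cong unmark (sym (take-mark d k w)) ⟩
  unmark (take (double k) (mark d w))               ≡⟨ cong unmark st ⟩
  unmark (revbar (drop (double m ∸ double k) (mark d w))) ≡⟨ unmark-revbar (drop (double m ∸ double k) (mark d w)) ⟩
  revbar (unmark (drop (double m ∸ double k) (mark d w))) ≡⟨ cong (λ n → revbar (unmark (drop n (mark d w)))) (sym (double-∸ m k)) ⟩
  revbar (unmark (drop (double (m ∸ k)) (mark d w)))      ≡⟨ cong (λ u → revbar (unmark u)) (drop-mark d (m ∸ k) w) ⟩
  revbar (unmark (mark (d ∸ (m ∸ k)) (drop (m ∸ k) w)))  ≡⟨ cong revbar (unmark-mark _ _ (drop⁺ (m ∸ k) bw)) ⟩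
  revbar (drop (m ∸ k) w)                           ∎
  where open ≡-Reasoning

_⊇_ : V → V → Set
(i , m) ⊇ (i' , m') = i ≤ i' × i' + m' ≤ i + m

⊇-trans : ∀ {u v w} → u ⊇ v → v ⊇ w → u ⊇ w
⊇-trans (a , b) (c , d) = ≤-trans a c , ≤-trans d b

deletionʳ-⊇ : ∀ i m ℓ → (i , m) ⊇ (i , m ∸ ℓ)
deletionʳ-⊇ i m ℓ = ≤-refl , +-monoʳ-≤ i (m∸n≤m m ℓ)

deletionˡ-⊇ : ∀ i m ℓ → ℓ ≤ m / 2 → (i , m) ⊇ (i + ℓ , m ∸ ℓ)
deletionˡ-⊇ i m ℓ p = m≤m+n i ℓ , ≤-reflexive (trans (+-assoc i ℓ (m ∸ ℓ)) (cong (i +_) (m+[n∸m]≡n (≤/2⇒≤ p))))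

delEdge-⊇ : ∀ {x u v} → DelEdge x u v → u ⊇ v
delEdge-⊇ (delLeft i m ℓ _ p _ _)  = deletionˡ-⊇ i m ℓ p
delEdge-⊇ (delRight i m ℓ _ _ _ _) = deletionʳ-⊇ i m ℓ

hpEdge-⊇ : ∀ {x u v} → HPEdge x u v → u ⊇ v
hpEdge-⊇ (hpRight i m ℓ _ _ _ _) = deletionʳ-⊇ i m ℓ
hpEdge-⊇ (hpLeft i m ℓ _ p _ _)  = deletionˡ-⊇ i m ℓ p

module _ {E : V → V → Set} where

  path-⊇ : (∀ {u v} → E u v → u ⊇ v) → ∀ {u w n} → Path E u w n → u ⊇ w
  path-⊇ e⊇ here       = ≤-refl , ≤-refl
  path-⊇ e⊇ (step e p) = ⊇-trans (e⊇ e) (path-⊇ e⊇ p)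

  path-zero : ∀ {u w} → Path E u w 0 → u ≡ w
  path-zero here = refl

  path-suc : ∀ {u w n} → Path E u w (suc n) → ∃ λ v → E u v × Path E v w n
  path-suc (step e p) = _ , e , p

module _ {E E' : V → V → Set} {s s' : V} {P P' : V → Set} where

  DistIs-cong : (∀ n → ReachIn E s P n ⇔ ReachIn E' s' P' n) → ∀ n → DistIs E s P n ⇔ DistIs E' s' P' n
  DistIs-cong r n =
    mk⇔ (λ (p , min) → to (r n) p , λ k k<n q → min k k<n (from (r k) q))
        (λ (p , min) → from (r n) p , λ k k<n q → min k k<n (to (r k) q))
    where open Equivalence

ReachIn-unique : ∀ {E s P t} → P t → (∀ {v} → P v → v ≡ t) → ∀ n → ReachIn E s P n ⇔ Path E s t n
ReachIn-unique {E} {s} pt unique n =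
  mk⇔ (λ (v , pv , p) → subst (λ w → Path E s w n) (unique pv) p) (λ p → _ , pt , p)

doubleV : V → V
doubleV (i , m) = double i , double m

module Transfer (x y : Word) (L j0 : ℕ) (binary : All Binary x)
  (x[L]≡1 : at0 x L ≡ just s1) (x[L+1]≡1 : at0 x (1 + L) ≡ just s1)
  (x[L+2]≡0 : at0 x (2 + L) ≡ just s0) (x[L+3]≡0 : at0 x (3 + L) ≡ just s0)
  (no11-before : ∀ o → suc o < L → at0 x o ≡ just s1 → at0 x (suc o) ≡ just s1 → ⊥)
  (no00-after : ∀ o → 4 + L ≤ o → at0 x o ≡ just s0 → at0 x (suc o) ≡ just s0 → ⊥)
  (j0≤L : j0 ≤ L) (4+L≤j0+ly : 4 + L ≤ j0 + length y) (j0+ly≤x : j0 + length y ≤ length x)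
  (occurs : sub x j0 (length y) ≡ y)
  where

  ly : ℕ
  ly = length y

  -- md is x_mid, the 1-based position of the second 1 of the pattern, so x' is prime x.
  md : ℕ
  md = 2 + L

  x' : Word
  x' = mark md x

  y' : Word
  y' = mark (md ∸ j0) y

  t : V
  t = j0 , ly

  t' : V
  t' = doubleV t

  DE : V → V → Set
  DE = DelEdge x

  HE : V → V → Set
  HE = HPEdge x'

  L<md : L < md
  L<md = n≤1+n _

  double-bound : ∀ {a m} → a + m ≤ length x → double a + double m ≤ length x'
  double-bound {a} {m} p = subst₂ _≤_ (double-+ a m) (sym (length-mark md x)) (double-mono-≤ p)

  stem-double : ∀ {a m k} → a + m ≤ length x → k ≤ m → a + k ≤ md → md ≤ a + (m ∸ k) →
                Stem (sub x a m) m k → Stem (sub x' (double a) (double m)) (double m) (double k)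
  stem-double {a} {m} {k} am≤x k≤m a+k≤md md≤a+[m∸k] st =
    subst (λ W → Stem W (double m) (double k)) (sym (sub-mark md x a m))
      (stem-mark (md ∸ a) (sub x a m) m k (length-sub x a m am≤x) k≤m
        (m+n≤o⇒m≤o∸n k (subst (_≤ md) (+-comm a k) a+k≤md))
        (subst (md ∸ a ≤_) (m+n∸m≡n a (m ∸ k)) (∸-monoˡ-≤ a md≤a+[m∸k])) st)

  stem-halve : ∀ {a m k} → Stem (sub x' (double a) (double m)) (double m) (double k) → Stem (sub x a m) m k
  stem-halve {a} {m} {k} st = stem-unmark (md ∸ a) (sub x a m) m k (take⁺ m (drop⁺ a binary))
                                (subst (λ W → Stem W (double m) (double k)) (sub-mark md x a m) st)

  stem-mirror : ∀ {a m k} → a + m ≤ length x → k ≤ m → Stem (sub x a m) m k →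
                ∀ r s → r < k → suc (r + s) ≡ m → at0 x (a + r) ≡ Maybe.map bar (at0 x (a + s))
  stem-mirror {a} {m} {k} am≤x k≤m st r s r<k e = begin
    at0 x (a + r)                          ≡⟨ sym (at0-sub x a m r (≤-trans r<k k≤m)) ⟩
    at0 (sub x a m) r                      ≡⟨ stem-at0 (sub x a m) m k (length-sub x a m am≤x) k≤m st r r<k ⟩
    Maybe.map bar (at0 (sub x a m) (m ∸ suc r)) ≡⟨ cong (λ n → Maybe.map bar (at0 (sub x a m) n)) m∸sr≡s ⟩
    Maybe.map bar (at0 (sub x a m) s)      ≡⟨ cong (Maybe.map bar) (at0-sub x a m s s<m) ⟩
    Maybe.map bar (at0 x (a + s))          ∎
    where
    open ≡-Reasoning
    m∸sr≡s : m ∸ suc r ≡ s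
    m∸sr≡s = trans (cong (_∸ suc r) (sym e)) (m+n∸m≡n (suc r) s)
    s<m : s < m
    s<m = subst (s <_) e (s≤s (m≤n+m s r))

  -- Mirroring the pattern's 11 through a stem yields a 00 beyond it, and mirroring its 00 yields a 11 before it.

  stem-prefix-before-switch : ∀ {a m k} → a + m ≤ length x → k ≤ m → Stem (sub x a m) m k →
                              a ≤ L → 4 + L ≤ a + (m ∸ k) → a + k < md
  stem-prefix-before-switch {a} {m} {k} am≤x k≤m st a≤L 4+L≤ = ≰⇒> reaches
    where
    reaches : md ≤ a + k → ⊥
    reaches md≤a+k = no00-after (a + s) 4+L≤a+s (map-bar-just _ s1 x[a+s]) (map-bar-just _ s1 x[a+s+1])
      where
      r : ℕ
      r = L ∸ a
      a+r≡L : a + r ≡ L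
      a+r≡L = m+[n∸m]≡n a≤L
      2+r≤k : 2 + r ≤ k
      2+r≤k = +-cancelˡ-≤ a _ _ (subst (_≤ a + k) (trans (cong (2 +_) (sym a+r≡L)) (shift a r)) md≤a+k)
        where
        shift : ∀ a r → 2 + (a + r) ≡ a + (2 + r)
        shift = solve-∀
      s : ℕ
      s = m ∸ (2 + r)
      2+r+s≡m : 2 + r + s ≡ m
      2+r+s≡m = m+[n∸m]≡n (≤-trans 2+r≤k k≤m)
      x[a+s] : Maybe.map bar (at0 x (a + s)) ≡ just s1
      x[a+s] = trans (sym (stem-mirror am≤x k≤m st (suc r) s 2+r≤k 2+r+s≡m))
                     (trans (cong (at0 x) (trans (+-suc a r) (cong suc a+r≡L))) x[L+1]≡1)
      x[a+s+1] : Maybe.map bar (at0 x (suc (a + s))) ≡ just s1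
      x[a+s+1] = trans (cong (λ n → Maybe.map bar (at0 x n)) (sym (+-suc a s)))
                   (trans (sym (stem-mirror am≤x k≤m st r (suc s) (≤-trans (n≤1+n _) 2+r≤k)
                                            (trans (cong suc (+-suc r s)) 2+r+s≡m)))
                          (trans (cong (at0 x) a+r≡L) x[L]≡1))
      4+L≤a+s : 4 + L ≤ a + s
      4+L≤a+s = ≤-trans 4+L≤ (+-monoʳ-≤ a (∸-monoʳ-≤ m 2+r≤k))

  stem-suffix-after-switch : ∀ {a m k} → a + m ≤ length x → k ≤ m → Stem (sub x a m) m k →
                             a + k ≤ L → 4 + L ≤ a + m → md < a + (m ∸ k)
  stem-suffix-after-switch {a} {m} {k} am≤x k≤m st a+k≤L 4+L≤ = ≰⇒> reaches
    where
    reaches : a + (m ∸ k) ≤ md → ⊥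
    reaches a+[m∸k]≤md = no11-before (a + s) a+s+1<L x[a+s] x[a+s+1]
      where
      r : ℕ
      r = md ∸ a
      a+r≡md : a + r ≡ md
      a+r≡md = m+[n∸m]≡n (≤-trans (≤-trans (m≤m+n a k) a+k≤L) (<⇒≤ L<md))
      2+r≤m : 2 + r ≤ m
      2+r≤m = +-cancelˡ-≤ a _ _ (subst (_≤ a + m) (trans (cong (2 +_) (sym a+r≡md)) (shift a r)) 4+L≤)
        where
        shift : ∀ a r → 2 + (a + r) ≡ a + (2 + r)
        shift = solve-∀
      s : ℕ
      s = m ∸ (2 + r)
      2+r+s≡m : 2 + r + s ≡ m
      2+r+s≡m = m+[n∸m]≡n 2+r≤m
      2+s≤k : 2 + s ≤ k
      2+s≤k = +-cancelʳ-≤ r _ _ (subst (_≤ k + r) (trans 2+r+s≡m′ (sym (shift r s))) (≤-trans (m≤n+m∸n m k) (+-monoʳ-≤ k m∸k≤r)))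
        where
        shift : ∀ r s → 2 + s + r ≡ 2 + r + s
        shift = solve-∀
        2+r+s≡m′ : m ≡ 2 + r + s
        2+r+s≡m′ = sym 2+r+s≡m
        m∸k≤r : m ∸ k ≤ r
        m∸k≤r = +-cancelˡ-≤ a _ _ (subst (a + (m ∸ k) ≤_) (sym a+r≡md) a+[m∸k]≤md)
      x[a+s] : at0 x (a + s) ≡ just s1
      x[a+s] = trans (stem-mirror am≤x k≤m st s (suc r) (≤-trans (n≤1+n _) 2+s≤k) (trans (rearrange r s) 2+r+s≡m))
                     (cong (Maybe.map bar) (trans (cong (at0 x) (trans (+-suc a r) (cong suc a+r≡md))) x[L+3]≡0))
        where
        rearrange : ∀ r s → suc (s + suc r) ≡ 2 + r + s
        rearrange = solve-∀
      x[a+s+1] : at0 x (suc (a + s)) ≡ just s1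
      x[a+s+1] = trans (cong (at0 x) (sym (+-suc a s)))
                   (trans (stem-mirror am≤x k≤m st (suc s) r 2+s≤k (trans (rearrange r s) 2+r+s≡m))
                          (cong (Maybe.map bar) (trans (cong (at0 x) a+r≡md) x[L+2]≡0)))
        where
        rearrange : ∀ r s → suc (suc s + r) ≡ 2 + r + s
        rearrange = solve-∀
      a+s+1<L : suc (a + s) < L
      a+s+1<L = subst (_≤ L) (shift a s) (≤-trans (+-monoʳ-≤ a 2+s≤k) a+k≤L)
        where
        shift : ∀ a s → a + (2 + s) ≡ 2 + (a + s)
        shift = solve-∀

  -- The switch of x' separates the stem's prefix from its suffix, so the marks supply complementary inner ends 2 and 2̄.
  hairpins-of-stem : ∀ {a m k} → 1 ≤ k → k ≤ m / 2 → a + m ≤ length x → Stem (sub x a m) m k →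
                     a + k < md → md < a + (m ∸ k) →
                     HE (doubleV (a , m)) (doubleV (a , m ∸ k)) × HE (doubleV (a , m)) (doubleV (a + k , m ∸ k))
  hairpins-of-stem {a} {m} {k} 1≤k k≤m/2 am≤x st a+k<md md<a+[m∸k] =
      subst (HE (doubleV (a , m))) (cong (double a ,_) (sym (double-∸ m k)))
            (hpRight-of-stem x' (double a) (double m) (double k) j 1≤2k 2k≤2m/2 bound (stem-double am≤x k≤m (<⇒≤ a+k<md) (<⇒≤ md<a+[m∸k]) st) sj≡2m∸2k 2k≤j x'[2a+2k] x'[2a+j])
    , subst (HE (doubleV (a , m))) (cong₂ _,_ (sym (double-+ a k)) (sym (double-∸ m k)))
            (hpLeft-of-stem x' (double a) (double m) (double k) j 1≤2k 2k≤2m/2 bound (stem-double am≤x k≤m (<⇒≤ a+k<md) (<⇒≤ md<a+[m∸k]) st) sj≡2m∸2k 2k≤j x'[2a+2k] x'[2a+j])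
    where
    k≤m : k ≤ m
    k≤m = ≤/2⇒≤ k≤m/2
    a+[m∸k]≤x : a + (m ∸ k) ≤ length x
    a+[m∸k]≤x = ≤-trans (+-monoʳ-≤ a (m∸n≤m m k)) am≤x
    q : ℕ
    q = m ∸ k ∸ 1
    1+q≡m∸k : 1 + q ≡ m ∸ k
    1+q≡m∸k = m+[n∸m]≡n (+-cancelˡ-≤ a 1 (m ∸ k) (subst (_≤ a + (m ∸ k)) (+-comm 1 a) a<a+[m∸k]))
      where
      a<a+[m∸k] : a < a + (m ∸ k)
      a<a+[m∸k] = ≤-trans (s≤s (m≤m+n a k)) (≤-trans a+k<md (<⇒≤ md<a+[m∸k]))
    a+sq≡ : a + suc q ≡ a + (m ∸ k)
    a+sq≡ = cong (a +_) 1+q≡m∸k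
    k≤q : k ≤ q
    k≤q = ≤-pred (+-cancelˡ-≤ a _ _ (subst (a + suc k ≤_) (sym a+sq≡) (≤-trans (subst (_≤ md) (sym (+-suc a k)) a+k<md) (<⇒≤ md<a+[m∸k]))))
    j : ℕ
    j = suc (double q)
    sj≡2m∸2k : suc j ≡ double m ∸ double k
    sj≡2m∸2k = trans (cong double 1+q≡m∸k) (double-∸ m k)
    2k≤j : double k ≤ j
    2k≤j = ≤-trans (double-mono-≤ k≤q) (n≤1+n _)
    1≤2k : 1 ≤ double k
    1≤2k = ≤-trans (s≤s z≤n) (double-mono-≤ 1≤k)
    2k≤2m/2 : double k ≤ double m / 2
    2k≤2m/2 = subst (double k ≤_) (sym (double/2 m)) (≤/2⇒double≤ k≤m/2)
    bound : double a + double m ≤ length x'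
    bound = double-bound {a} {m} am≤x
    x'[2a+2k] : at0 x' (double a + double k) ≡ just s2
    x'[2a+2k] = trans (cong (at0 x') (sym (double-+ a k)))
                      (at0-mark-left-even md x (a + k) a+k<md (≤-trans (≤-trans a+k<md (<⇒≤ md<a+[m∸k])) a+[m∸k]≤x))
    x'[2a+j] : at0 x' (double a + j) ≡ just s2b
    x'[2a+j] = trans (cong (at0 x') (trans (+-suc (double a) (double q)) (cong suc (sym (double-+ a q)))))
                     (at0-mark-right-odd md x (a + q) md≤a+q (subst (_≤ length x) (trans (sym a+sq≡) (+-suc a q)) a+[m∸k]≤x))
      where
      md≤a+q : md ≤ a + q
      md≤a+q = ≤-pred (subst (md <_) (trans (sym a+sq≡) (+-suc a q)) md<a+[m∸k])

  forward-edge : ∀ {u v} → DE u v → u ⊇ t → v ⊇ t → HE (doubleV u) (doubleV v)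
  forward-edge (delRight a m k 1≤k k≤m/2 am≤x st) _ (a≤j0 , j0+ly≤) =
    proj₁ (hairpins-of-stem 1≤k k≤m/2 am≤x st
            (stem-prefix-before-switch am≤x (≤/2⇒≤ k≤m/2) st (≤-trans a≤j0 j0≤L) 4+L≤a+[m∸k])
            (≤-trans (n≤1+n _) 4+L≤a+[m∸k]))
    where 4+L≤a+[m∸k] = ≤-trans 4+L≤j0+ly j0+ly≤
  forward-edge (delLeft a m k 1≤k k≤m/2 am≤x st) (_ , j0+ly≤a+m) (a+k≤j0 , _) =
    proj₂ (hairpins-of-stem 1≤k k≤m/2 am≤x st
            (s≤s (≤-trans a+k≤L (n≤1+n L)))
            (stem-suffix-after-switch am≤x (≤/2⇒≤ k≤m/2) st a+k≤L (≤-trans 4+L≤j0+ly j0+ly≤a+m)))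
    where a+k≤L = ≤-trans a+k≤j0 j0≤L

  forward : ∀ {u n} → Path DE u t n → Path HE (doubleV u) t' n
  forward here       = here
  forward (step e p) = step (forward-edge e (⊇-trans (delEdge-⊇ e) v⊇t) v⊇t) (forward p)
    where v⊇t = path-⊇ delEdge-⊇ p

  1≤ly : 1 ≤ ly
  1≤ly = +-cancelˡ-≤ j0 1 ly (≤-trans (subst (_≤ 4 + L) (+-comm 1 j0) (s≤s (≤-trans j0≤L (m≤n+m L 3)))) 4+L≤j0+ly)

  j0<x : j0 < length x
  j0<x = ≤-trans (subst (_≤ j0 + ly) (+-comm j0 1) (+-monoʳ-≤ j0 1≤ly)) j0+ly≤x

  -- The ends of an odd-length vertex around the target are a 2 facing an even position (never 2̄),
  -- or an odd position (never 2) facing a 2̄, so no hairpin deletion applies to it.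
  odd-length-dead-end : ∀ {i q n} → (i , suc (double q)) ⊇ t' → Path HE (i , suc (double q)) t' n → ⊥
  odd-length-dead-end {i} {q} {zero} _ p = double≢odd ly q (sym (cong proj₂ (path-zero p)))
  odd-length-dead-end {i} {q} {suc n} (i≤2j0 , 2[j0+ly]≤) p with path-suc p | even-or-odd i
  ... | _ , e , _ | u , inj₁ refl =
      at0-mark-even≢2̄ md x (u + q) binary
        (subst (λ n → at0 x' n ≡ just s2b) (sym (double-+ u q)) (map-bar-just _ s2 (trans (sym (hpEdge-ends e)) x'[2u])))
    where
    u≤j0 : u ≤ j0
    u≤j0 = double-cancel-≤ i≤2j0
    x'[2u] : at0 x' (double u) ≡ just s2
    x'[2u] = at0-mark-left-even md x u (s≤s (≤-trans (≤-trans u≤j0 j0≤L) (n≤1+n L))) (≤-trans (s≤s u≤j0) j0<x)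
  ... | _ , e , _ | u , inj₂ refl = at0-mark-odd≢2 md x u binary (trans (hpEdge-ends e) (cong (Maybe.map bar) x'[end]))
    where
    odd+odd : suc (double u) + suc (double q) ≡ double (suc (u + q))
    odd+odd = cong suc (trans (+-suc (double u) (double q)) (cong suc (sym (double-+ u q))))
    md≤u+q : md ≤ u + q
    md≤u+q = ≤-trans (n≤1+n md) (≤-pred (≤-trans 4+L≤j0+ly (double-cancel-≤ (subst₂ _≤_ (sym (double-+ j0 ly)) odd+odd 2[j0+ly]≤))))
    u+q<x : u + q < length x
    u+q<x = double-cancel-≤ (subst₂ _≤_ odd+odd (length-mark md x) (hpEdge-bound e))
    x'[end] : at0 x' (suc (double u) + double q) ≡ just s2b
    x'[end] = trans (cong (at0 x') (cong suc (sym (double-+ u q)))) (at0-mark-right-odd md x (u + q) md≤u+q u+q<x)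

  odd-deletion-dead-end : ∀ {i m k n} → suc (double k) ≤ double m / 2 → Path HE (i , double m ∸ suc (double k)) t' n → ⊥
  odd-deletion-dead-end {i} {m} {k} {n} 2k+1≤2m/2 p = odd-length-dead-end (path-⊇ hpEdge-⊇ p') p'
    where
    k<m : suc k ≤ m
    k<m = ≤-trans (s≤s (subst (k ≤_) (sym (double≡+ k)) (m≤m+n k k))) (subst (suc (double k) ≤_) (double/2 m) 2k+1≤2m/2)
    p' : Path HE (i , suc (double (m ∸ suc k))) t' n
    p' = subst (λ M → Path HE (i , M) t' n) (double-∸-odd k<m) p

  halve-bound : ∀ {a m} → double a + double m ≤ length x' → a + m ≤ length x
  halve-bound {a} {m} p = double-cancel-≤ (subst₂ _≤_ (sym (double-+ a m)) (length-mark md x) p)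

  backward : ∀ n {a m} → Path HE (doubleV (a , m)) t' n → Path DE (a , m) t n
  backward zero {a} {m} p =
    subst (λ v → Path DE v t 0) (sym (cong₂ _,_ (double-injective (cong proj₁ e)) (double-injective (cong proj₂ e)))) here
    where e = path-zero p
  backward (suc n) {a} {m} p with path-suc p
  ... | _ , hpRight _ _ ℓ 1≤ℓ ℓ≤2m/2 bound h , p' with even-or-odd ℓ
  ...   | k , inj₂ refl = ⊥-elim (odd-deletion-dead-end {m = m} ℓ≤2m/2 p')
  ...   | k , inj₁ refl =
    step (delRight a m k (1≤double⁻ 1≤ℓ) (halve-≤/2 {k} {m} ℓ≤2m/2) (halve-bound {a} {m} bound) (stem-halve {a} {m} {k} (RightHP⇒Stem _ _ _ (length-sub x' _ _ bound) (≤/2⇒+≤ ℓ≤2m/2) h)))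
         (backward n (subst (λ M → Path HE (double a , M) t' n) (sym (double-∸ m k)) p'))
  backward (suc n) {a} {m} p | _ , hpLeft _ _ ℓ 1≤ℓ ℓ≤2m/2 bound h , p' with even-or-odd ℓ
  ...   | k , inj₂ refl = ⊥-elim (odd-deletion-dead-end {m = m} ℓ≤2m/2 p')
  ...   | k , inj₁ refl =
    step (delLeft a m k (1≤double⁻ 1≤ℓ) (halve-≤/2 {k} {m} ℓ≤2m/2) (halve-bound {a} {m} bound) (stem-halve {a} {m} {k} (LeftHP⇒Stem _ _ _ (length-sub x' _ _ bound) (≤/2⇒+≤ ℓ≤2m/2) h)))
         (backward n (subst₂ (λ i M → Path HE (i , M) t' n) (sym (double-+ a k)) (sym (double-∸ m k)) p'))

  pattern-unique : ∀ o → at0 x o ≡ just s1 → at0 x (1 + o) ≡ just s1 → at0 x (2 + o) ≡ just s0 → at0 x (3 + o) ≡ just s0 →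
                   o ≡ L
  pattern-unique o x[o] x[o+1] x[o+2] x[o+3] with <-cmp o L
  ... | tri≈ _ o≡L _ = o≡L
  ... | tri< o<L _ _ with m≤n⇒m<n∨m≡n o<L
  ...   | inj₁ 1+o<L = ⊥-elim (no11-before o 1+o<L x[o] x[o+1])
  ...   | inj₂ 1+o≡L = ⊥-elim (1≢0 (trans (sym (trans (cong (λ n → at0 x (suc n)) 1+o≡L) x[L+1]≡1)) x[o+2]))
    where
    1≢0 : just s1 ≢ just s0
    1≢0 ()
  pattern-unique o x[o] x[o+1] x[o+2] x[o+3] | tri> _ _ L<o with m≤n⇒m<n∨m≡n L<o
  ...   | inj₁ 1+L<o = ⊥-elim (no00-after (2 + o) (s≤s (s≤s 1+L<o)) x[o+2] x[o+3])
  ...   | inj₂ 1+L≡o = ⊥-elim (1≢0 (trans (sym x[o+1]) (trans (cong (λ n → at0 x (suc n)) (sym 1+L≡o)) x[L+2]≡0)))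
    where
    1≢0 : just s1 ≢ just s0
    1≢0 ()

  -- Every occurrence of y contains the pattern at the same offset.
  occurrence-unique : ∀ {j} → sub x j ly ≡ y → j ≡ j0
  occurrence-unique {j} sub≡y =
    +-cancelʳ-≡ p j j0 (trans (pattern-unique (j + p) (same 0 (s≤s z≤n) x[L]≡1) (same 1 (s≤s (s≤s z≤n)) x[L+1]≡1)
                                  (same 2 (s≤s (s≤s (s≤s z≤n))) x[L+2]≡0) (same 3 ≤-refl x[L+3]≡0))
                              (sym j0+p≡L))
    where
    p : ℕ
    p = L ∸ j0
    j0+p≡L : j0 + p ≡ L
    j0+p≡L = m+[n∸m]≡n j0≤L
    same : ∀ r {c} → r < 4 → at0 x (r + L) ≡ just c → at0 x (r + (j + p)) ≡ just c
    same r r<4 x[r+L] = begin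
      at0 x (r + (j + p))        ≡⟨ cong (at0 x) (rearrange r j p) ⟩
      at0 x (j + (p + r))        ≡⟨ sym (at0-sub x j ly (p + r) p+r<ly) ⟩
      at0 (sub x j ly) (p + r)   ≡⟨ cong (λ w → at0 w (p + r)) (trans sub≡y (sym occurs)) ⟩
      at0 (sub x j0 ly) (p + r)  ≡⟨ at0-sub x j0 ly (p + r) p+r<ly ⟩
      at0 x (j0 + (p + r))       ≡⟨ cong (at0 x) j0+[p+r]≡r+L ⟩
      at0 x (r + L)              ≡⟨ x[r+L] ⟩
      _                          ∎
      where
      open ≡-Reasoning
      rearrange : ∀ r j p → r + (j + p) ≡ j + (p + r)
      rearrange = solve-∀
      j0+[p+r]≡r+L : j0 + (p + r) ≡ r + L
      j0+[p+r]≡r+L = trans (sym (+-assoc j0 p r)) (trans (cong (_+ r) j0+p≡L) (+-comm L r))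
      p+r<ly : p + r < ly
      p+r<ly = +-cancelˡ-≤ j0 _ _ (subst (_≤ j0 + ly) (sym (trans (+-suc j0 (p + r)) (cong suc j0+[p+r]≡r+L)))
                                        (≤-trans (+-monoˡ-≤ L r<4) 4+L≤j0+ly))

  binary-y : All Binary y
  binary-y = subst (All Binary) occurs (take⁺ ly (drop⁺ j0 binary))

  occurrence'-unique : ∀ {v} → Occ x' y' v → v ≡ t'
  occurrence'-unique {i , M} (M≡ , _ , sub≡y') with even-or-odd i
  ... | u , inj₂ refl = ⊥-elim (at0-mark-odd≢2 md x u binary x'[i]≡2)
    where
    0<M : 0 < M
    0<M = subst (0 <_) (sym (trans M≡ (length-mark _ y))) (≤-trans 1≤ly (subst (ly ≤_) (sym (double≡+ ly)) (m≤m+n ly ly)))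
    x'[i]≡2 : at0 x' (suc (double u)) ≡ just s2
    x'[i]≡2 = trans (cong (at0 x') (sym (+-identityʳ _)))
                (trans (sym (at0-sub x' (suc (double u)) M 0 0<M))
                  (trans (cong (λ w → at0 w 0) sub≡y')
                    (at0-mark-left-even (md ∸ j0) y 0 (m+n≤o⇒m≤o∸n 1 (s≤s (≤-trans j0≤L (n≤1+n L)))) 1≤ly)))
  ... | u , inj₁ refl = cong₂ _,_ (cong double (occurrence-unique sub≡y)) M≡2ly
    where
    open ≡-Reasoning
    M≡2ly : M ≡ double ly
    M≡2ly = trans M≡ (length-mark _ y)
    sub≡y : sub x u ly ≡ y
    sub≡y = begin
      sub x u ly                              ≡⟨ sym (unmark-mark (md ∸ u) _ (take⁺ ly (drop⁺ u binary))) ⟩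
      unmark (mark (md ∸ u) (sub x u ly))     ≡⟨ cong unmark (sym (sub-mark md x u ly)) ⟩
      unmark (sub x' (double u) (double ly))  ≡⟨ cong (λ n → unmark (sub x' (double u) n)) (sym M≡2ly) ⟩
      unmark (sub x' (double u) M)            ≡⟨ cong unmark sub≡y' ⟩
      unmark y'                               ≡⟨ unmark-mark _ y binary-y ⟩
      y                                       ∎

  occurrence-at : ∀ {v} → Occ x y v → v ≡ t
  occurrence-at {i , m} (refl , _ , sub≡y) = cong (_, ly) (occurrence-unique sub≡y)

  occurs-at-t : Occ x y t
  occurs-at-t = refl , j0+ly≤x , occurs

  occurs-at-t' : Occ x' y' t'
  occurs-at-t' = sym (length-mark _ y) , double-bound {j0} {ly} j0+ly≤x , trans (sub-mark md x j0 ly) (cong (mark (md ∸ j0)) occurs)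

  paths⇔ : ∀ n → Path DE (0 , length x) t n ⇔ Path HE (0 , length x') t' n
  paths⇔ n = mk⇔ (λ p → subst (λ M → Path HE (0 , M) t' n) (sym (length-mark md x)) (forward p))
                 (λ p → backward n (subst (λ M → Path HE (0 , M) t' n) (length-mark md x) p))

  distance-preserved : ∀ n → DistIs DE (0 , length x) (Occ x y) n ⇔ DistIs HE (0 , length x') (Occ x' y') n
  distance-preserved = DistIs-cong λ n →
    ⇔.trans (ReachIn-unique occurs-at-t occurrence-at n)
            (⇔.trans (paths⇔ n) (⇔.sym (ReachIn-unique occurs-at-t' occurrence'-unique n)))

_≟_ : DecidableEquality Sym
s0  ≟ s0  = yes refl
s0  ≟ s1  = no λ ()
s0  ≟ s2  = no λ ()
s0  ≟ s2b = no λ ()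
s1  ≟ s0  = no λ ()
s1  ≟ s1  = yes refl
s1  ≟ s2  = no λ ()
s1  ≟ s2b = no λ ()
s2  ≟ s0  = no λ ()
s2  ≟ s1  = no λ ()
s2  ≟ s2  = yes refl
s2  ≟ s2b = no λ ()
s2b ≟ s0  = no λ ()
s2b ≟ s1  = no λ ()
s2b ≟ s2  = no λ ()
s2b ≟ s2b = yes refl

NotPair : Sym → Sym → Sym → Set
NotPair s a b = ¬ (a ≡ s × b ≡ s)

NoRepeat : Sym → Word → Set
NoRepeat s = Linked (NotPair s)

noRepeat? : ∀ s w → Dec (NoRepeat s w)
noRepeat? s = linked? λ a b → ¬? ((a ≟ s) ×-dec (b ≟ s))

binary? : ∀ c → Dec (Binary c)
binary? s0  = yes 0-binary
binary? s1  = yes 1-binary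
binary? s2  = no λ ()
binary? s2b = no λ ()

NoRepeat-at0 : ∀ {s} A o → NoRepeat s A → at0 A o ≡ just s → at0 A (suc o) ≡ just s → ⊥
NoRepeat-at0 (a ∷ [])    zero    _          _    ()
NoRepeat-at0 (a ∷ b ∷ A) zero    (ab ∷ _)   refl refl = ab (refl , refl)
NoRepeat-at0 (a ∷ A)     (suc o) rep        e₁   e₂   = NoRepeat-at0 A o (Linked.tail rep) e₁ e₂

NoRepeat-++ : ∀ {s A B} → NoRepeat s A → NoRepeat s B → head B ≢ just s → NoRepeat s (A ++ B)
NoRepeat-++ {s} {A} {B} rA rB hB = ++⁺ᴸ rA (connected (last A) (head B) hB) rB
  where
  connected : ∀ m n → n ≢ just s → Connected (NotPair s) m n
  connected (just a) (just b) n≢s = just λ (_ , b≡s) → n≢s (cong just b≡s)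
  connected (just a) nothing  _   = just-nothing
  connected nothing  (just b) _   = nothing-just
  connected nothing  nothing  _   = nothing

NoRepeat-concatMap : ∀ {I : Set} {s} (f : I → Word) → (∀ i → NoRepeat s (f i)) → (∀ i → head (f i) ≢ just s) →
                     ∀ is → NoRepeat s (concatMap f is) × head (concatMap f is) ≢ just s
NoRepeat-concatMap f rep hd []       = [] , λ ()
NoRepeat-concatMap {s = s} f rep hd (i ∷ is) = NoRepeat-++ (rep i) rest hd-rest , head-++ (f i) (hd i)
  where
  rest : NoRepeat s (concatMap f is)
  rest = proj₁ (NoRepeat-concatMap f rep hd is)
  hd-rest : head (concatMap f is) ≢ just s
  hd-rest = proj₂ (NoRepeat-concatMap f rep hd is)
  head-++ : ∀ A → head A ≢ just s → head (A ++ concatMap f is) ≢ just s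
  head-++ []      _  = hd-rest
  head-++ (c ∷ A) hA = hA

startsPat-false : ∀ {c w B} → NoRepeat s1 (c ∷ w) → startsPat (c ∷ w ++ s1 ∷ s1 ∷ B) ≡ false
startsPat-false {s0}                 _          = refl
startsPat-false {s2}                 _          = refl
startsPat-false {s2b}                _          = refl
startsPat-false {s1} {[]}            _          = refl
startsPat-false {s1} {s0 ∷ w}        _          = refl
startsPat-false {s1} {s2 ∷ w}        _          = refl
startsPat-false {s1} {s2b ∷ w}       _          = refl
startsPat-false {s1} {s1 ∷ w}        (¬11 ∷ _)  = ⊥-elim (¬11 (refl , refl))

findPat-skip : ∀ i A {B} → NoRepeat s1 A → findPat i (A ++ s1 ∷ s1 ∷ B) ≡ findPat (i + length A) (s1 ∷ s1 ∷ B)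
findPat-skip i []     {B} _   = cong (λ n → findPat n (s1 ∷ s1 ∷ B)) (sym (+-identityʳ i))
findPat-skip i (c ∷ A) {B} rep rewrite startsPat-false {c} {A} {B} rep =
  trans (findPat-skip (suc i) A (Linked.tail rep)) (cong (λ n → findPat n (s1 ∷ s1 ∷ B)) (sym (+-suc i (length A))))

mid-pattern : ∀ A B → NoRepeat s1 A → mid (A ++ s1 ∷ s1 ∷ s0 ∷ s0 ∷ B) ≡ 2 + length A
mid-pattern A B rep =
  trans (cong (λ r → fromMaybe 0 (Maybe.map (λ p → p + 2) r)) (findPat-skip 0 A rep)) (+-comm (length A) 2)

module Pattern (Lw Rw x : Word) (x≡ : x ≡ Lw ++ s1 ∷ s1 ∷ s0 ∷ s0 ∷ Rw)
               (no11 : NoRepeat s1 Lw) (no00 : NoRepeat s0 Rw) where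

  L : ℕ
  L = length Lw

  at-pattern : ∀ r → at0 x (r + L) ≡ at0 (s1 ∷ s1 ∷ s0 ∷ s0 ∷ Rw) r
  at-pattern r = trans (cong₂ at0 x≡ (+-comm r L)) (at0-++ʳ Lw _ r)

  x[L]≡1 : at0 x L ≡ just s1
  x[L]≡1 = at-pattern 0

  x[L+1]≡1 : at0 x (1 + L) ≡ just s1
  x[L+1]≡1 = at-pattern 1

  x[L+2]≡0 : at0 x (2 + L) ≡ just s0
  x[L+2]≡0 = at-pattern 2

  x[L+3]≡0 : at0 x (3 + L) ≡ just s0
  x[L+3]≡0 = at-pattern 3

  no11-before : ∀ o → suc o < L → at0 x o ≡ just s1 → at0 x (suc o) ≡ just s1 → ⊥
  no11-before o so<L x[o] x[o+1] = NoRepeat-at0 Lw o no11 (trans (sym (in-Lw (≤-trans (n≤1+n _) so<L))) x[o]) (trans (sym (in-Lw so<L)) x[o+1])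
    where
    in-Lw : ∀ {r} → r < L → at0 x r ≡ at0 Lw r
    in-Lw {r} r<L = trans (cong (λ w → at0 w r) x≡) (at0-++ˡ Lw _ r r<L)

  no00-after : ∀ o → 4 + L ≤ o → at0 x o ≡ just s0 → at0 x (suc o) ≡ just s0 → ⊥
  no00-after o 4+L≤o x[o] x[o+1] = NoRepeat-at0 Rw d no00 (trans (sym (in-Rw d)) (trans (cong (at0 x) o≡) x[o]))
                                                         (trans (sym (in-Rw (suc d))) (trans (cong (at0 x) (cong suc o≡)) x[o+1]))
    where
    d : ℕ
    d = o ∸ (4 + L)
    o≡ : 4 + d + L ≡ o
    o≡ = trans (cong (4 +_) (+-comm d L)) (m+[n∸m]≡n 4+L≤o)
    in-Rw : ∀ r → at0 x (4 + r + L) ≡ at0 Rw r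
    in-Rw r = at-pattern (4 + r)

  mid≡ : mid x ≡ 2 + L
  mid≡ = trans (cong mid x≡) (mid-pattern Lw Rw no11)

EL-no11 : ∀ a → NoRepeat s1 (EL a)
EL-no11 = from-yes (all-Fin? λ a → noRepeat? s1 (EL a))

ER-no00 : ∀ a → NoRepeat s0 (ER a)
ER-no00 = from-yes (all-Fin? λ a → noRepeat? s0 (ER a))

EL-binary : ∀ a → All Binary (EL a)
EL-binary = from-yes (all-Fin? λ a → all? binary? (EL a))

ER-binary : ∀ a → All Binary (ER a)
ER-binary = from-yes (all-Fin? λ a → all? binary? (ER a))

EL-head : ∀ a → head (EL a) ≢ just s1
EL-head Fin.zero                       ()
EL-head (Fin.suc Fin.zero)             ()
EL-head (Fin.suc (Fin.suc Fin.zero))   ()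

ER-head : ∀ a → head (ER a) ≢ just s0
ER-head Fin.zero                       ()
ER-head (Fin.suc Fin.zero)             ()
ER-head (Fin.suc (Fin.suc Fin.zero))   ()

-- y is a parameter (later yStr) and x is spelled exactly as in xStr: otherwise conversion checks unfold the
-- concrete words letter by letter, which is prohibitively slow.
module Construction (S T : List (Fin 3)) (y yLeft yRight : Word) (y≡ : y ≡ yLeft ++ s1 ∷ s1 ∷ s0 ∷ s0 ∷ yRight)
                    (yLeft-no11 : NoRepeat s1 yLeft) (yLeft-head : head yLeft ≢ just s1) (yRight-no00 : NoRepeat s0 yRight)
                    (y-binary : All Binary y) where

  left : Word
  left = concatMap EL S

  right : Word
  right = concatMap ER (reverse T)

  x : Word
  x = concatMap EL S ++ y ++ concatMap ER (reverse T)

  Lw : Word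
  Lw = left ++ yLeft

  Rw : Word
  Rw = yRight ++ right

  j0 : ℕ
  j0 = length left

  ly : ℕ
  ly = length y

  x≡ : x ≡ Lw ++ s1 ∷ s1 ∷ s0 ∷ s0 ∷ Rw
  x≡ = begin
    left ++ y ++ right                                          ≡⟨ cong (λ y → left ++ y ++ right) y≡ ⟩
    left ++ (yLeft ++ s1 ∷ s1 ∷ s0 ∷ s0 ∷ yRight) ++ right      ≡⟨ cong (left ++_) (++-assoc yLeft _ right) ⟩
    left ++ yLeft ++ s1 ∷ s1 ∷ s0 ∷ s0 ∷ Rw                     ≡⟨ sym (++-assoc left yLeft _) ⟩
    Lw ++ s1 ∷ s1 ∷ s0 ∷ s0 ∷ Rw                                ∎
    where open ≡-Reasoning

  no11 : NoRepeat s1 Lw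
  no11 = NoRepeat-++ (proj₁ (NoRepeat-concatMap EL EL-no11 EL-head S)) yLeft-no11 yLeft-head

  no00 : NoRepeat s0 Rw
  no00 = NoRepeat-++ yRight-no00 (proj₁ right-ok) (proj₂ right-ok)
    where
    right-ok : NoRepeat s0 right × head right ≢ just s0
    right-ok = NoRepeat-concatMap ER ER-no00 ER-head (reverse T)

  binary : All Binary x
  binary = ++⁺ (concat⁺ (map⁺ (universal EL-binary S))) (++⁺ y-binary (concat⁺ (map⁺ (universal ER-binary (reverse T)))))

  open Pattern Lw Rw x x≡ no11 no00

  L≡ : L ≡ j0 + length yLeft
  L≡ = length-++ left

  4+L≤j0+ly : 4 + L ≤ j0 + ly
  4+L≤j0+ly = begin
    4 + L                                      ≡⟨ cong (4 +_) L≡ ⟩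
    4 + (j0 + length yLeft)                    ≡⟨ arrange j0 (length yLeft) ⟩
    j0 + (length yLeft + 4)                    ≤⟨ +-monoʳ-≤ j0 (+-monoʳ-≤ (length yLeft) (m≤m+n 4 (length yRight))) ⟩
    j0 + (length yLeft + (4 + length yRight))  ≡⟨ cong (j0 +_) (sym (trans (cong length y≡) (length-++ yLeft))) ⟩
    j0 + ly                                    ∎
    where
    open ≤-Reasoning
    arrange : ∀ j a → 4 + (j + a) ≡ j + (a + 4)
    arrange = solve-∀

  j0≤L : j0 ≤ L
  j0≤L = subst (j0 ≤_) (sym L≡) (m≤m+n j0 _)

  j0+ly≤x : j0 + ly ≤ length x
  j0+ly≤x = subst (j0 + ly ≤_) (sym (trans (length-++ left) (cong (j0 +_) (length-++ y))))
                  (+-monoʳ-≤ j0 (m≤m+n ly (length right)))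

  occurs : sub x j0 ly ≡ y
  occurs = trans (cong (take ly) (drop-++-length left (y ++ right))) (take-++-length y right)

  open Transfer x y L j0 binary x[L]≡1 x[L+1]≡1 x[L+2]≡0 x[L+3]≡0 no11-before no00-after
                j0≤L 4+L≤j0+ly j0+ly≤x occurs
    using (distance-preserved) public

  prime-x : prime x ≡ mark (2 + L) x
  prime-x = trans (prime≡mark x) (cong (λ d → mark d x) mid≡)

  prime-y : prime y ≡ mark (2 + L ∸ j0) y
  prime-y = trans (prime≡mark y) (cong (λ d → mark d y) (trans (trans (cong mid y≡) (mid-pattern yLeft yRight yLeft-no11)) (sym shift)))
    where
    arrange : ∀ j a → 2 + (j + a) ≡ j + (2 + a)
    arrange = solve-∀
    shift : 2 + L ∸ j0 ≡ 2 + length yLeft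
    shift = trans (cong (λ l → 2 + l ∸ j0) L≡) (trans (cong (_∸ j0) (arrange j0 (length yLeft))) (m+n∸m≡n j0 _))

yLeft : Word
yLeft = PL ++ SyncL ++ s0 ∷ s1 ∷ []

yRight : Word
yRight = (s0 ∷ s1 ∷ []) ++ SyncR ++ PR

lemma32 : (S T : List (Fin 3)) (n : ℕ) → distG S T n ⇔ distG' S T n
lemma32 S T n =
  subst₂ (λ x' y' → distG S T n ⇔ DistIs (HPEdge x') (0 , length x') (Occ x' y') n)
         (sym prime-x) (sym prime-y) (distance-preserved n)
  where
  open Construction S T yStr yLeft yRight refl (from-yes (noRepeat? s1 yLeft)) (λ ()) (from-yes (noRepeat? s0 yRight))
                    (from-yes (all? binary? yStr))
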